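{- Let $T$ be a text of length $n$, let $\theta\ge 2$ be an integer, and fix any state (current array $P$ and set of created referencing factors) reached by the plcpcomp procedure with threshold $\theta$. Let $s$ be a text position, let $i\ge s$ be the smallest position $\ge s$ that is a maximal peak, and let $j_1<j_2<\dots<j_m$ be all interesting peaks lying in $[s,i)$ (i.e., the list $L$ of interesting peaks collected while scanning from $s$ until the maximal peak $i$ is found). Then $P[j_1]<P[j_2]<\dots<P[j_m]$.
   Context: A text $T=T[1..n]$ is a string over an integer alphabet whose last character $T[n]=\$$ occurs nowhere else and is lexicographically smaller than all other characters; $T[i..]$ denotes the suffix starting at position $i$. For each position $i$, let $\Phi[i]$ be the starting position of the suffix that immediately precedes $T[i..]$ in the lexicographic order of all suffixes of $T$ (and $\Phi[i]:=n$ if $T[i..]$ is the smallest suffix), and let $\mathrm{PLCP}[i]$ be the length of the longest common prefix of $T[i..]$ and $T[\Phi[i]..]$ (and $0$ if $T[i..]$ is the smallest suffix). The plcpcomp procedure with threshold $\theta$ maintains a rewritable integer array $P[1..n]$, initially $P=\mathrm{PLCP}$, and a set of referencing factors, initially empty. It repeats: (1) let $i$ be the leftmost position with $P[i]\ge P[j]$ for all $j$; (2) if $P[i]<\theta$, stop; (3) create the referencing factor $T[i..i+P[i]-1]$ with reference $(\Phi[i],P[i])$; (4) with $\ell:=P[i]$ (value before this step), set $P[j]\gets\min(P[j],i-j)$ for every $j\in[i-\ell,i)$ (rule D) and set $P[i+k]\gets 0$ for every $k\in[0,\ell)$ (rule R); then repeat. With respect to a state (current array $P$ and current set of created referencing factors),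 a position $i$ is a peak if $P[i]\ge\theta$ and at least one of the following holds: $i=1$; $P[i-1]<P[i]$; some created referencing factor ends at position $i-1$. A peak $i$ is interesting if there is no position $j$ with $i\in(j,j+P[j])$ (open interval) and $P[j]\ge P[i]$. An interesting peak $i$ is maximal if there is no interesting peak $j$ with $j\in(i,i+P[i])$. -}

module Defs where

open import Data.Nat using (ℕ; zero; suc; _+_; _∸_; _≤_; _<_; _⊓_; _≟_; _<ᵇ_; _≤ᵇ_)
open import Data.Bool using (Bool; true; false; if_then_else_; _∧_)
open import Data.List using (List; []; _∷_; _++_; [_]; drop; length)
open import Data.List.Relation.Unary.All using (All)
open import Data.List.Relation.Binary.Lex.Strict using (Lex-<)
open import Data.List.Membership.Propositional using (_∈_)
open import Data.Product using (Σ; ∃; ∃₂; _×_; _,_)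
open import Data.Sum using (_⊎_)
open import Relation.Nullary using (¬_; does)
open import Relation.Binary.PropositionalEquality using (_≡_)

-- Texts are lists over the integer alphabet ℕ; positions are 1-indexed,
-- i.e. valid positions of T are 1 … length T.

WellFormedText : List ℕ → Set
WellFormedText T = ∃₂ λ w d → (T ≡ w ++ [ d ]) × All (d <_) w

suffix : List ℕ → ℕ → List ℕ
suffix T i = drop (i ∸ 1) T

SufLt : List ℕ → ℕ → ℕ → Set
SufLt T i j = Lex-< _≡_ _<_ (suffix T i) (suffix T j)

InRange : List ℕ → ℕ → Set
InRange T i = (1 ≤ i) × (i ≤ length T)

lcp : List ℕ → List ℕ → ℕ
lcp [] _ = 0
lcp (_ ∷ _) [] = 0
lcp (x ∷ xs) (y ∷ ys) = if does (x ≟ y) then suc (lcp xs ys) else 0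

IsPhi : List ℕ → ℕ → ℕ → Set
IsPhi T i p =
  (InRange T p × SufLt T p i × (∀ q → InRange T q → SufLt T q i → ¬ SufLt T p q))
  ⊎ ((∀ q → InRange T q → ¬ SufLt T q i) × p ≡ length T)

IsPLCP : List ℕ → ℕ → ℕ → Set
IsPLCP T i v =
  (∃ λ p → InRange T p × SufLt T p i × (∀ q → InRange T q → SufLt T q i → ¬ SufLt T p q)
           × v ≡ lcp (suffix T i) (suffix T p))
  ⊎ ((∀ q → InRange T q → ¬ SufLt T q i) × v ≡ 0)

-- a referencing factor T[start .. start+len-1] with reference (ref , len)
record Factor : Set where
  constructor factor
  field
    start : ℕ
    ref   : ℕ
    len   : ℕ

-- a state of plcpcomp: the rewritable array P (meaningful on positions 1..n)
-- and the set (as a list) of created referencing factors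
record State : Set where
  constructor state
  field
    arr     : ℕ → ℕ
    factors : List Factor
open State public

-- rules D and R applied at position i with ℓ = P[i]
update : (ℕ → ℕ) → ℕ → (ℕ → ℕ)
update P i j =
  let ℓ = P i in
  if (i ∸ ℓ ≤ᵇ j) ∧ (j <ᵇ i) then P j ⊓ (i ∸ j)
  else if (i ≤ᵇ j) ∧ (j <ᵇ i + ℓ) then 0
  else P j

LeftmostMax : List ℕ → (ℕ → ℕ) → ℕ → Set
LeftmostMax T P i =
  InRange T i × (∀ j → InRange T j → P j ≤ P i) × (∀ j → 1 ≤ j → j < i → P j < P i)

data Reachable (T : List ℕ) (θ : ℕ) : State → Set where
  init : (P : ℕ → ℕ) → (∀ i → InRange T i → IsPLCP T i (P i)) →
         Reachable T θ (state P [])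
  step : ∀ {P F} → Reachable T θ (state P F) →
         (i : ℕ) → LeftmostMax T P i → θ ≤ P i →
         (p : ℕ) → IsPhi T i p →
         Reachable T θ (state (update P i) (factor i p (P i) ∷ F))

Peak : List ℕ → ℕ → State → ℕ → Set
Peak T θ S i =
  InRange T i × θ ≤ arr S i ×
  (i ≡ 1 ⊎ arr S (i ∸ 1) < arr S i
   ⊎ ∃ λ f → f ∈ factors S × Factor.start f + Factor.len f ∸ 1 ≡ i ∸ 1)

InterestingPeak : List ℕ → ℕ → State → ℕ → Set
InterestingPeak T θ S i =
  Peak T θ S i ×
  ¬ (∃ λ j → InRange T j × j < i × i < j + arr S j × arr S i ≤ arr S j)

MaximalPeak : List ℕ → ℕ → State → ℕ → Set
MaximalPeak T θ S i =
  InterestingPeak T θ S i ×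
  ¬ (∃ λ j → InterestingPeak T θ S j × i < j × j < i + arr S i)

module Submission where

-- Let j₁ < j₂ be interesting
-- peaks with no maximal peak in [j₁, j₂).  Suppose P[j₁] ≥ P[j₂].  Then
-- j₂ cannot lie inside the range (j₁, j₁ + P[j₁]) of j₁, since j₂ is
-- interesting (`leaves-range`).  As j₁ is not maximal, some interesting
-- peak j' lies in (j₁, j₁ + P[j₁]), hence j' < j₂; being interesting inside
-- the range of j₁ forces P[j₁] < P[j'] (`inside-range-higher`), and by
-- induction on the gap j₂ - j₁ we get P[j'] < P[j₂], a contradiction.
-- Non-maximality only yields the inner peak j' under a double negation,
-- which is harmless because the goal P[j₁] < P[j₂] is decidable.

open import Defs
open import Data.Nat using (ℕ; zero; suc; _+_; _≤_; _<_; _<?_)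
open import Data.Nat.Properties
  using (≮⇒≥; <⇒≱; <-trans; <-≤-trans; ≤-refl; ≤-trans; <⇒≤; <-irrefl; +-identityʳ; +-suc; +-monoˡ-≤; m≤n+m)
open import Data.List using (List)
open import Data.Product using (∃; _×_; _,_; proj₁)
open import Relation.Nullary using (¬_; yes; no; contradiction)
open import Relation.Nullary.Decidable using (decidable-stable)
open import Relation.Binary.PropositionalEquality using (refl; subst; sym)

module _ (T : List ℕ) (θ : ℕ) (S : State) where

  private
    P : ℕ → ℕ
    P = arr S

  -- An interesting peak j lying strictly inside the range of a peak k
  -- is strictly higher than k; otherwise k would witness that j is not
  -- interesting.
  inside-range-higher : ∀ {k j} → Peak T θ S k → InterestingPeak T θ S j →
                        k < j → j < k + P k → P k < P j
  inside-range-higher {k} {j} peak-k (_ , uncovered) k<j j<end with P k <? P j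
  ... | yes higher = higher
  ... | no not-higher =
    contradiction (k , proj₁ peak-k , k<j , j<end , ≮⇒≥ not-higher) uncovered

  leaves-range : ∀ {k j} → Peak T θ S k → InterestingPeak T θ S j →
                 k < j → P j ≤ P k → k + P k ≤ j
  leaves-range {k} {j} peak-k int-j k<j k-as-high with j <? k + P k
  ... | yes j<end = contradiction k-as-high (<⇒≱ (inside-range-higher peak-k int-j k<j j<end))
  ... | no j≮end = ≮⇒≥ j≮end

  increase-within : (n : ℕ) → ∀ {j₁ j₂} → j₂ ≤ j₁ + n → j₁ < j₂ →
                    (∀ k → j₁ ≤ k → k < j₂ → ¬ MaximalPeak T θ S k) →
                    InterestingPeak T θ S j₁ → InterestingPeak T θ S j₂ →
                    P j₁ < P j₂
  increase-within zero {j₁} j₂≤j₁ j₁<j₂ _ _ _ =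
    contradiction (<-≤-trans j₁<j₂ (subst (_ ≤_) (+-identityʳ j₁) j₂≤j₁)) (<-irrefl refl)
  increase-within (suc n) {j₁} {j₂} bound j₁<j₂ no-max int₁ int₂ =
    decidable-stable (P j₁ <? P j₂) λ not-higher →
      no-max j₁ ≤-refl j₁<j₂ (int₁ , no-inner-peak not-higher)
    where
      -- If P[j₁] ≥ P[j₂], no interesting peak j' lies in the range of j₁:
      -- such a j' precedes j₂ and P[j₁] < P[j'] < P[j₂] by induction.
      no-inner-peak : ¬ (P j₁ < P j₂) →
                      ¬ (∃ λ j' → InterestingPeak T θ S j' × j₁ < j' × j' < j₁ + P j₁)
      no-inner-peak not-higher (j' , int' , j₁<j' , j'<end) =
        not-higher (<-trans (inside-range-higher (proj₁ int₁) int' j₁<j' j'<end)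
                            (increase-within n bound' j'<j₂ no-max' int' int₂))
        where
          j'<j₂ : j' < j₂
          j'<j₂ = <-≤-trans j'<end (leaves-range (proj₁ int₁) int₂ j₁<j₂ (≮⇒≥ not-higher))
          bound' : j₂ ≤ j' + n
          bound' = ≤-trans bound (subst (_≤ j' + n) (sym (+-suc j₁ n)) (+-monoˡ-≤ n j₁<j'))
          no-max' : ∀ k → j' ≤ k → k < j₂ → ¬ MaximalPeak T θ S k
          no-max' k j'≤k = no-max k (≤-trans (<⇒≤ j₁<j') j'≤k)

  interesting-peaks-increase : ∀ {j₁ j₂} → j₁ < j₂ →
                               (∀ k → j₁ ≤ k → k < j₂ → ¬ MaximalPeak T θ S k) →
                               InterestingPeak T θ S j₁ → InterestingPeak T θ S j₂ →
                               P j₁ < P j₂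
  interesting-peaks-increase {j₁} {j₂} = increase-within j₂ (m≤n+m j₂ j₁)

lemma3 : (T : List ℕ) → WellFormedText T → (θ : ℕ) → 2 ≤ θ →
         (S : State) → Reachable T θ S →
         (s : ℕ) → InRange T s →
         (i : ℕ) → s ≤ i → MaximalPeak T θ S i →
         (∀ k → s ≤ k → k < i → ¬ MaximalPeak T θ S k) →
         (j₁ j₂ : ℕ) → s ≤ j₁ → j₁ < j₂ → j₂ < i →
         InterestingPeak T θ S j₁ → InterestingPeak T θ S j₂ →
         arr S j₁ < arr S j₂
lemma3 T _ θ _ S _ s _ i _ _ no-max-before-i j₁ j₂ s≤j₁ j₁<j₂ j₂<i int₁ int₂ =
  interesting-peaks-increase T θ S j₁<j₂ no-max-in-gap int₁ int₂
  where
    no-max-in-gap : ∀ k → j₁ ≤ k → k < j₂ → ¬ MaximalPeak T θ S k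
    no-max-in-gap k j₁≤k k<j₂ = no-max-before-i k (≤-trans s≤j₁ j₁≤k) (<-trans k<j₂ j₂<i)
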